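{- Let $\alpha,\beta$ be complex numbers with $\alpha+\beta=-1$. For $n\ge1$, $$\sum_{\sigma\in\mathfrak S_{n+1}}u^{{\rm M}(\sigma)}\alpha^{{\rm LRmin}(\sigma)-1}\beta^{{\rm RLmin}(\sigma)-1}=\begin{cases}(1-u)^{\lfloor n/2\rfloor},& n\text{ even},\\ -(1-u)^{\lfloor n/2\rfloor},& n\text{ odd}.\end{cases}$$
   Context: $\mathfrak S_m$ is the set of permutations $\sigma=\sigma_1\cdots\sigma_m$ of $[m]$. ${\rm M}(\sigma)$ is the number of interior peaks: $i$ with $1<i<m$ and $\sigma_{i-1}<\sigma_i>\sigma_{i+1}$. ${\rm LRmin}(\sigma)$ (resp. ${\rm RLmin}(\sigma)$) is the number of entries $\sigma_i$ smaller than all entries to their left (resp. right). -}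

module Defs where

open import Data.Nat using (ℕ; zero; suc; _∸_; _<ᵇ_; _≡ᵇ_)
open import Data.Bool using (Bool; true; false; if_then_else_; _∧_; not)
open import Data.List using (List; []; _∷_; map; concatMap; upTo; filterᵇ; foldr)
open import Data.Bool.ListAction using (all; any)
open import Algebra.Bundles using (CommutativeRing)
open import Level using (Level)

-- Permutations of [m] = {1,…,m} in one-line notation σ₁⋯σₘ, as lists of ℕ.

words : ℕ → ℕ → List (List ℕ)
words m zero    = [] ∷ []
words m (suc k) = concatMap (λ w → map (λ a → a ∷ w) (map suc (upTo m))) (words m k)

distinct : List ℕ → Bool
distinct []       = true
distinct (x ∷ xs) = not (any (x ≡ᵇ_) xs) ∧ distinct xs

perms : ℕ → List (List ℕ)
perms m = filterᵇ distinct (words m m)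

peaks : List ℕ → ℕ
peaks (a ∷ b ∷ c ∷ xs) = (if (a <ᵇ b) ∧ (c <ᵇ b) then 1 else 0) + peaks (b ∷ c ∷ xs)
  where open Data.Nat using (_+_)
peaks _ = 0

-- LRmin: entries smaller than every entry to their left
-- (first argument = entries already seen, i.e. to the left)
lrminAux : List ℕ → List ℕ → ℕ
lrminAux pre []       = 0
lrminAux pre (x ∷ xs) = (if all (x <ᵇ_) pre then 1 else 0) + lrminAux (x ∷ pre) xs
  where open Data.Nat using (_+_)

LRmin : List ℕ → ℕ
LRmin σ = lrminAux [] σ

RLmin : List ℕ → ℕ
RLmin []       = 0
RLmin (x ∷ xs) = (if all (x <ᵇ_) xs then 1 else 0) + RLmin xs
  where open Data.Nat using (_+_)

module _ {c ℓ : Level} (R : CommutativeRing c ℓ) where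
  open CommutativeRing R

  pow : Carrier → ℕ → Carrier
  pow x zero    = 1#
  pow x (suc n) = x * pow x n

  sumR : List Carrier → Carrier
  sumR = foldr _+_ 0#

  permSum : ℕ → Carrier → Carrier → Carrier → Carrier
  permSum m u α β =
    sumR (map (λ σ → pow u (peaks σ) * (pow α (LRmin σ ∸ 1) * pow β (RLmin σ ∸ 1))) (perms m))

{-# OPTIONS --safe #-}
-- Insert the maximum m + 1 into σ ∈ 𝔖ₘ. In front it creates a new left-to-right minimum, at the end
-- a new right-to-left minimum, and in each of the n = m − 1 interior gaps it changes neither; there
-- the number of peaks goes from k to k + 1, except for the 2k gaps next to one of the k peaks of σ,
-- where it stays k. So for g : ℕ → R and Sₘ(g) = Σ_σ g(M σ) α^(LRmin σ − 1) β^(RLmin σ − 1), the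
-- relation α + β = −1 gives S_(m+1)(g) = Sₘ(T_(m−1) g) with (Tₙ g)(k) = n g(k+1) + 2k (Δg)(k) − g(k),
-- where (Δg)(k) = g(k) − g(k+1). A Leibniz rule for k ↦ k f(k) yields Δʲ(T_(2j) g)(0) = −(Δʲg)(0)
-- and Δʲ(T_(2j+1) g)(0) = −(Δʲ⁺¹g)(0), hence S_(2j+1)(g) = (Δʲg)(0) and S_(2j+2)(g) = −(Δʲg)(0).
-- Finally (Δʲg)(0) = (1 − u)ʲ for g(k) = uᵏ.
module Submission where

open import Defs
open import Level using (Level)
open import Algebra.Bundles using (CommutativeRing)

module Permutations where
  open import Data.Nat using (ℕ; zero; suc; _≤_; _<_; z≤n; s≤s; _≟_; _≡ᵇ_)
  open import Data.Nat.Properties using (≤-refl; ≤-trans; ≤-pred; m≤n⇒m≤1+n; ≤∧≢⇒<; <⇒≢; suc-injective; ≡ᵇ⇒≡; ≡⇒≡ᵇ; 1+n≰n)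
  open import Data.Bool using (true; false; T; not)
  open import Data.Bool.Properties using (T-∧)
  open import Data.Bool.ListAction using (any)
  open import Data.List using (List; []; _∷_; [_]; map; concatMap; upTo; length; _++_; filter; cartesianProductWith)
  open import Data.List.Properties using (∷-injectiveˡ; ∷-injectiveʳ; filter-all; filter-reject; map-id-local)
  open import Data.List.Relation.Unary.All as All using (All; []; _∷_)
  open import Data.List.Relation.Unary.All.Properties using (¬Any⇒All¬) renaming (map⁺ to All-map⁺)
  open import Data.List.Relation.Unary.Any as Any using (here; there)
  open import Data.List.Relation.Unary.AllPairs as AllPairs using ([]; _∷_)
  import Data.List.Relation.Unary.AllPairs.Properties as AllPairs
  open import Data.List.Relation.Unary.Unique.Propositional using (Unique)
  import Data.List.Relation.Unary.Unique.Propositional.Properties as Unique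
  open import Data.List.Relation.Binary.Disjoint.Propositional using (Disjoint)
  open import Data.List.Membership.Propositional using (_∈_; find)
  open import Data.List.Membership.Propositional.Properties
    using (∈-concatMap⁺; ∈-concatMap⁻; ∈-map⁺; ∈-map⁻; ∈-upTo⁺; ∈-upTo⁻; ∈-filter⁺; ∈-filter⁻; ∈-∃++; ∈-cartesianProductWith⁺; ∈-cartesianProductWith⁻)
  open import Data.List.Membership.DecPropositional _≟_ using (_∈?_)
  open import Data.List.Membership.Propositional.Properties.WithK using (unique∧set⇒bag)
  open import Data.List.Relation.Binary.BagAndSetEquality using (∼bag⇒↭)
  open import Data.List.Relation.Binary.Permutation.Propositional
    using (_↭_; ↭-refl; ↭-sym; ↭-trans; prep; swap) renaming (refl to ↭-refl′; trans to ↭-trans′)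
  open import Data.List.Relation.Binary.Permutation.Propositional.Properties using (All-resp-↭; ↭-length; shift)
  open import Data.Product using (_×_; _,_)
  open import Function using (_∘_; flip; Equivalence; mk⇔)
  open import Relation.Nullary using (yes; no; ¬?; does; contradiction)
  open import Relation.Nullary.Decidable using (T?)
  open import Relation.Unary using (Decidable)
  open import Relation.Binary.PropositionalEquality using (_≡_; _≢_; refl; sym; trans; cong; subst)

  Unique-resp-↭ : ∀ {A : Set} {xs ys : List A} → xs ↭ ys → Unique xs → Unique ys
  Unique-resp-↭ ↭-refl′ u = u
  Unique-resp-↭ (prep x p) (x∉ ∷ u) = All-resp-↭ p x∉ ∷ Unique-resp-↭ p u
  Unique-resp-↭ (swap x y p) ((x≢y ∷ x∉) ∷ y∉ ∷ u) =
    (x≢y ∘ sym ∷ All-resp-↭ p y∉) ∷ All-resp-↭ p x∉ ∷ Unique-resp-↭ p u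
  Unique-resp-↭ (↭-trans′ p q) u = Unique-resp-↭ q (Unique-resp-↭ p u)

  concatMap-map≡cartesianProductWith : ∀ {A B C : Set} (f : A → B → C) xs ys →
    concatMap (λ x → map (f x) ys) xs ≡ cartesianProductWith f xs ys
  concatMap-map≡cartesianProductWith f [] ys = refl
  concatMap-map≡cartesianProductWith f (x ∷ xs) ys =
    cong (map (f x) ys ++_) (concatMap-map≡cartesianProductWith f xs ys)

  letters : ℕ → List ℕ
  letters m = map suc (upTo m)

  InRange : ℕ → ℕ → Set
  InRange m a = 1 ≤ a × a ≤ m

  ∈-letters⁺ : ∀ {m a} → InRange m a → a ∈ letters m
  ∈-letters⁺ {a = suc a} (_ , a<m) = ∈-map⁺ suc (∈-upTo⁺ a<m)

  ∈-letters⁻ : ∀ {m a} → a ∈ letters m → InRange m a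
  ∈-letters⁻ a∈ with _ , i∈ , refl ← ∈-map⁻ suc a∈ = s≤s z≤n , ∈-upTo⁻ i∈

  InRange-pred : ∀ {n xs} → All (InRange (suc n)) xs → All (suc n ≢_) xs → All (InRange n) xs
  InRange-pred r ne = All.zipWith (λ { ((1≤a , a≤1+n) , ne) → 1≤a , ≤-pred (≤∧≢⇒< a≤1+n (ne ∘ sym)) }) (r , ne)

  words-suc : ∀ m k → words m (suc k) ≡ cartesianProductWith (flip _∷_) (words m k) (letters m)
  words-suc m k = concatMap-map≡cartesianProductWith (flip _∷_) (words m k) (letters m)

  ∈-words⁺ : ∀ {m} w → All (InRange m) w → w ∈ words m (length w)
  ∈-words⁺ [] [] = here refl
  ∈-words⁺ {m} (a ∷ w) (a∈ ∷ w∈) rewrite words-suc m (length w) =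
    ∈-cartesianProductWith⁺ (flip _∷_) (∈-words⁺ w w∈) (∈-letters⁺ a∈)

  ∈-words⁻ : ∀ {m} k {w} → w ∈ words m k → length w ≡ k × All (InRange m) w
  ∈-words⁻ zero (here refl) = refl , []
  ∈-words⁻ {m} (suc k) w∈ rewrite words-suc m k
    with v , a , v∈ , a∈ , refl ← ∈-cartesianProductWith⁻ (flip _∷_) (words m k) (letters m) w∈
    with refl , v∈′ ← ∈-words⁻ k v∈ = refl , ∈-letters⁻ a∈ ∷ v∈′

  words-unique : ∀ m k → Unique (words m k)
  words-unique m zero = [] ∷ []
  words-unique m (suc k) rewrite words-suc m k =
    Unique.cartesianProductWith⁺ (flip _∷_) (λ eq → ∷-injectiveʳ eq , ∷-injectiveˡ eq)
      (words-unique m k) (Unique.map⁺ suc-injective (Unique.upTo⁺ m))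

  fresh⁺ : ∀ x xs → All (x ≢_) xs → T (not (any (x ≡ᵇ_) xs))
  fresh⁺ x [] [] = _
  fresh⁺ x (y ∷ ys) (x≢y ∷ x∉) with x ≡ᵇ y in eq
  ... | true  = x≢y (≡ᵇ⇒≡ x y (subst T (sym eq) _))
  ... | false = fresh⁺ x ys x∉

  fresh⁻ : ∀ x xs → T (not (any (x ≡ᵇ_) xs)) → All (x ≢_) xs
  fresh⁻ x [] _ = []
  fresh⁻ x (y ∷ ys) t with x ≡ᵇ y in eq
  ... | false = (λ { refl → subst T eq (≡⇒≡ᵇ x x refl) }) ∷ fresh⁻ x ys t

  distinct⇒Unique : ∀ σ → T (distinct σ) → Unique σ
  distinct⇒Unique [] _ = []
  distinct⇒Unique (x ∷ xs) t with x∉ , d ← Equivalence.to T-∧ t = fresh⁻ x xs x∉ ∷ distinct⇒Unique xs d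

  Unique⇒distinct : ∀ {σ} → Unique σ → T (distinct σ)
  Unique⇒distinct [] = _
  Unique⇒distinct {x ∷ xs} (x∉ ∷ u) = Equivalence.from T-∧ (fresh⁺ x xs x∉ , Unique⇒distinct u)

  IsPerm : ℕ → List ℕ → Set
  IsPerm m σ = length σ ≡ m × All (InRange m) σ × Unique σ

  ∈-perms⁺ : ∀ {m σ} → IsPerm m σ → σ ∈ perms m
  ∈-perms⁺ {σ = σ} (refl , r , u) = ∈-filter⁺ (T? ∘ distinct) (∈-words⁺ σ r) (Unique⇒distinct u)

  ∈-perms⁻ : ∀ {m σ} → σ ∈ perms m → IsPerm m σ
  ∈-perms⁻ {m} {σ} σ∈ with w∈ , d ← ∈-filter⁻ (T? ∘ distinct) {xs = words m m} σ∈
    with l , r ← ∈-words⁻ m w∈ = l , r , distinct⇒Unique σ d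

  perms-unique : ∀ m → Unique (perms m)
  perms-unique m = Unique.filter⁺ (T? ∘ distinct) (words-unique m m)

  IsPerm-resp-↭ : ∀ {m σ τ} → σ ↭ τ → IsPerm m σ → IsPerm m τ
  IsPerm-resp-↭ p (l , r , u) = trans (sym (↭-length p)) l , All-resp-↭ p r , Unique-resp-↭ p u

  IsPerm⇒<suc : ∀ {m σ} → IsPerm m σ → All (_< suc m) σ
  IsPerm⇒<suc (_ , r , _) = All.map (λ (_ , a≤m) → s≤s a≤m) r

  IsPerm-cons⁺ : ∀ {m σ} → IsPerm m σ → IsPerm (suc m) (suc m ∷ σ)
  IsPerm-cons⁺ p@(l , r , u) =
      cong suc l
    , (s≤s z≤n , ≤-refl) ∷ All.map (λ (1≤a , a≤m) → 1≤a , m≤n⇒m≤1+n a≤m) r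
    , All.map (λ a<top → <⇒≢ a<top ∘ sym) (IsPerm⇒<suc p) ∷ u

  IsPerm-cons⁻ : ∀ {m σ} → IsPerm (suc m) (suc m ∷ σ) → IsPerm m σ
  IsPerm-cons⁻ (l , _ ∷ r , top∉ ∷ u) = suc-injective l , InRange-pred r top∉ , u

  unique-length≤ : ∀ n {τ} → Unique τ → All (InRange n) τ → length τ ≤ n
  unique-length≤ zero {[]} _ _ = z≤n
  unique-length≤ zero {_ ∷ _} _ ((1≤a , a≤0) ∷ _) = contradiction (≤-trans 1≤a a≤0) λ ()
  unique-length≤ (suc n) {τ} u r with suc n ∈? τ
  ... | no top∉ = m≤n⇒m≤1+n (unique-length≤ n u (InRange-pred r (¬Any⇒All¬ τ top∉)))
  ... | yes top∈ with a , b , refl ← ∈-∃++ top∈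
    with top∉ ∷ u′ ← Unique-resp-↭ (shift (suc n) a b) u
       | _ ∷ r′ ← All-resp-↭ (shift (suc n) a b) r =
    subst (_≤ suc n) (sym (↭-length (shift (suc n) a b))) (s≤s (unique-length≤ n u′ (InRange-pred r′ top∉)))

  top∈perm : ∀ {m τ} → IsPerm (suc m) τ → suc m ∈ τ
  top∈perm {m} {τ} (l , r , u) with suc m ∈? τ
  ... | yes top∈ = top∈
  ... | no top∉ = contradiction (subst (_≤ m) l (unique-length≤ m u (InRange-pred r (¬Any⇒All¬ τ top∉)))) 1+n≰n

  ins : ℕ → ℕ → List ℕ → List ℕ
  ins M zero σ = M ∷ σ
  ins M (suc i) [] = [ M ]
  ins M (suc i) (x ∷ xs) = x ∷ ins M i xs

  insertions : ℕ → List ℕ → List (List ℕ)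
  insertions M [] = [ [ M ] ]
  insertions M (x ∷ xs) = (M ∷ x ∷ xs) ∷ map (x ∷_) (insertions M xs)

  insertions-↭ : ∀ M {σ τ} → τ ∈ insertions M σ → τ ↭ M ∷ σ
  insertions-↭ M {[]} (here refl) = ↭-refl
  insertions-↭ M {x ∷ xs} (here refl) = ↭-refl
  insertions-↭ M {x ∷ xs} (there τ∈) with τ′ , τ′∈ , refl ← ∈-map⁻ (x ∷_) τ∈ =
    ↭-trans (prep x (insertions-↭ M τ′∈)) (swap x M ↭-refl)

  ∈-insertions : ∀ M a b → a ++ M ∷ b ∈ insertions M (a ++ b)
  ∈-insertions M [] [] = here refl
  ∈-insertions M [] (_ ∷ _) = here refl
  ∈-insertions M (x ∷ a) b = there (∈-map⁺ (x ∷_) (∈-insertions M a b))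

  filter-∷-cong : ∀ {A : Set} {P : A → Set} (P? : Decidable P) x {xs ys} →
                  filter P? xs ≡ filter P? ys → filter P? (x ∷ xs) ≡ filter P? (x ∷ ys)
  filter-∷-cong P? x eq with does (P? x)
  ... | true = cong (x ∷_) eq
  ... | false = eq

  erase : ℕ → List ℕ → List ℕ
  erase M = filter (λ x → ¬? (x ≟ M))

  erase-insertion : ∀ M {σ τ} → τ ∈ insertions M σ → erase M τ ≡ erase M σ
  erase-insertion M {[]} (here refl) = filter-reject (λ x → ¬? (x ≟ M)) (λ ne → ne refl)
  erase-insertion M {x ∷ xs} (here refl) = filter-reject (λ x → ¬? (x ≟ M)) (λ ne → ne refl)
  erase-insertion M {x ∷ xs} (there τ∈) with τ′ , τ′∈ , refl ← ∈-map⁻ (x ∷_) τ∈ =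
    filter-∷-cong (λ x → ¬? (x ≟ M)) x (erase-insertion M τ′∈)

  insertions-unique : ∀ M {σ} → All (_≢ M) σ → Unique (insertions M σ)
  insertions-unique M {[]} _ = [] ∷ []
  insertions-unique M {x ∷ xs} (x≢M ∷ M∉) =
    All-map⁺ (All.universal (λ _ eq → x≢M (sym (∷-injectiveˡ eq))) _)
    ∷ Unique.map⁺ ∷-injectiveʳ (insertions-unique M M∉)

  insertions-disjoint : ∀ M {σ σ′} → erase M σ ≢ erase M σ′ → Disjoint (insertions M σ) (insertions M σ′)
  insertions-disjoint M ne (τ∈ , τ∈′) = ne (trans (sym (erase-insertion M τ∈)) (erase-insertion M τ∈′))

  concatMap-insertions-unique : ∀ M {σs} → Unique σs → All (All (_≢ M)) σs →
                                Unique (concatMap (insertions M) σs)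
  concatMap-insertions-unique M {σs} u M∉ =
    Unique.concat⁺ (All-map⁺ (All.map (insertions-unique M) M∉))
                   (AllPairs.map⁺ (AllPairs.map (insertions-disjoint M) (AllPairs.map⁻ erased-unique)))
    where
      erased-unique : Unique (map (erase M) σs)
      erased-unique = subst Unique (sym (map-id-local (All.map (filter-all (λ x → ¬? (x ≟ M))) M∉))) u

  perms-suc-↭ : ∀ m → perms (suc m) ↭ concatMap (insertions (suc m)) (perms m)
  perms-suc-↭ m = ∼bag⇒↭ (unique∧set⇒bag (perms-unique (suc m)) unique (mk⇔ split merge))
    where
      unique : Unique (concatMap (insertions (suc m)) (perms m))
      unique = concatMap-insertions-unique (suc m) (perms-unique m)
                 (All.tabulate λ σ∈ → All.map <⇒≢ (IsPerm⇒<suc (∈-perms⁻ {m} σ∈)))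
      split : ∀ {τ} → τ ∈ perms (suc m) → τ ∈ concatMap (insertions (suc m)) (perms m)
      split τ∈ with a , b , refl ← ∈-∃++ (top∈perm (∈-perms⁻ {suc m} τ∈)) =
        ∈-concatMap⁺ (insertions (suc m)) (Any.map (λ { refl → ∈-insertions (suc m) a b })
          (∈-perms⁺ (IsPerm-cons⁻ (IsPerm-resp-↭ (shift (suc m) a b) (∈-perms⁻ {suc m} τ∈)))))
      merge : ∀ {τ} → τ ∈ concatMap (insertions (suc m)) (perms m) → τ ∈ perms (suc m)
      merge τ∈ with σ , σ∈ , τ∈′ ← find (∈-concatMap⁻ (insertions (suc m)) {xs = perms m} τ∈) =
        ∈-perms⁺ (IsPerm-resp-↭ (↭-sym (insertions-↭ (suc m) τ∈′)) (IsPerm-cons⁺ (∈-perms⁻ {m} σ∈)))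

module InsertionStatistics where
  open Permutations using (ins)
  open import Data.Nat using (ℕ; zero; suc; _+_; _≤_; _<_; z≤n; s≤s; _<ᵇ_)
  open import Data.Nat.Properties using (≤-refl; ≤-trans; <⇒≤; ≤⇒≯; <ᵇ⇒<; <⇒<ᵇ; +-suc; +-assoc; +-identityʳ; m≤n+m)
  open import Data.Nat.Tactic.RingSolver using (solve-∀)
  open import Data.Bool using (Bool; true; false; _∧_; if_then_else_)
  open import Data.Bool.Properties using (T-≡; ∧-zeroʳ)
  open import Data.Bool.ListAction using (all)
  open import Data.List using (List; []; _∷_; length)
  open import Data.List.Relation.Unary.All using (All; []; _∷_)
  open import Function using (Equivalence)
  open import Relation.Nullary using (contradiction)
  open import Relation.Binary.PropositionalEquality using (_≡_; refl; trans; cong; cong₂; module ≡-Reasoning)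

  indicator : Bool → ℕ
  indicator b = if b then 1 else 0

  indicator≤1 : ∀ b → indicator b ≤ 1
  indicator≤1 true = ≤-refl
  indicator≤1 false = z≤n

  <ᵇ-true : ∀ {a b} → a < b → (a <ᵇ b) ≡ true
  <ᵇ-true a<b = Equivalence.to T-≡ (<⇒<ᵇ a<b)

  <ᵇ-false : ∀ {a b} → b ≤ a → (a <ᵇ b) ≡ false
  <ᵇ-false {a} {b} b≤a with a <ᵇ b in eq
  ... | true = contradiction (<ᵇ⇒< a b (Equivalence.from T-≡ eq)) (≤⇒≯ b≤a)
  ... | false = refl

  peakAfter : ℕ → List ℕ → ℕ
  peakAfter a (b ∷ c ∷ _) = indicator ((a <ᵇ b) ∧ (c <ᵇ b))
  peakAfter a _ = 0

  peakAt : List ℕ → ℕ → ℕ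
  peakAt [] _ = 0
  peakAt (a ∷ τ) zero = 0
  peakAt (a ∷ τ) (suc zero) = peakAfter a τ
  peakAt (a ∷ τ) (suc (suc i)) = peakAt τ (suc i)

  peaks-∷ : ∀ a τ → peaks (a ∷ τ) ≡ peakAfter a τ + peaks τ
  peaks-∷ a [] = refl
  peaks-∷ a (b ∷ []) = refl
  peaks-∷ a (b ∷ c ∷ _) = refl

  peakAfter≤1 : ∀ a τ → peakAfter a τ ≤ 1
  peakAfter≤1 a (b ∷ c ∷ _) = indicator≤1 ((a <ᵇ b) ∧ (c <ᵇ b))
  peakAfter≤1 a [] = z≤n
  peakAfter≤1 a (_ ∷ []) = z≤n

  peakAfter-below : ∀ {b c} τ → c < b → peakAfter b (c ∷ τ) ≡ 0
  peakAfter-below [] _ = refl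
  peakAfter-below (_ ∷ _) c<b rewrite <ᵇ-false (<⇒≤ c<b) = refl

  peakAfter-adjacent : ∀ a b c τ → peakAfter a (b ∷ c ∷ τ) + peakAfter b (c ∷ τ) ≤ 1
  peakAfter-adjacent a b c τ with c <ᵇ b in eq
  ... | true rewrite peakAfter-below τ (<ᵇ⇒< c b (Equivalence.from T-≡ eq)) | +-identityʳ (indicator ((a <ᵇ b) ∧ true)) =
    indicator≤1 _
  ... | false rewrite ∧-zeroʳ (a <ᵇ b) = peakAfter≤1 b (c ∷ τ)

  peakAt-adjacent : ∀ σ j → peakAt σ j + peakAt σ (suc j) ≤ 1
  peakAt-adjacent [] j = z≤n
  peakAt-adjacent (a ∷ τ) zero = peakAfter≤1 a τ
  peakAt-adjacent (a ∷ []) (suc zero) = z≤n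
  peakAt-adjacent (a ∷ b ∷ []) (suc zero) = z≤n
  peakAt-adjacent (a ∷ b ∷ c ∷ τ) (suc zero) = peakAfter-adjacent a b c τ
  peakAt-adjacent (a ∷ τ) (suc (suc j)) = peakAt-adjacent τ (suc j)

  peakAfter-top : ∀ M τ → All (_< M) τ → peakAfter M τ ≡ 0
  peakAfter-top M [] _ = refl
  peakAfter-top M (_ ∷ []) _ = refl
  peakAfter-top M (b ∷ c ∷ _) (b<M ∷ _) rewrite <ᵇ-false (<⇒≤ b<M) = refl

  peaks-top-∷ : ∀ M σ → All (_< M) σ → peaks (M ∷ σ) ≡ peaks σ
  peaks-top-∷ M σ σ<M = trans (peaks-∷ M σ) (cong (_+ peaks σ) (peakAfter-top M σ σ<M))

  peaks-ins-end : ∀ M σ → All (_< M) σ → peaks (ins M (length σ) σ) ≡ peaks σ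
  peaks-ins-end M [] _ = refl
  peaks-ins-end M (x ∷ xs) (x<M ∷ xs<M) = begin
    peaks (x ∷ ins M (length xs) xs)                     ≡⟨ peaks-∷ x (ins M (length xs) xs) ⟩
    peakAfter x (ins M (length xs) xs) + peaks (ins M (length xs) xs)
      ≡⟨ cong₂ _+_ (peakAfter-end xs xs<M) (peaks-ins-end M xs xs<M) ⟩
    peakAfter x xs + peaks xs                            ≡⟨ peaks-∷ x xs ⟨
    peaks (x ∷ xs)                                       ∎
    where
      open ≡-Reasoning
      peakAfter-end : ∀ xs → All (_< M) xs → peakAfter x (ins M (length xs) xs) ≡ peakAfter x xs
      peakAfter-end [] _ = refl
      peakAfter-end (y ∷ []) (y<M ∷ _) rewrite <ᵇ-false (<⇒≤ y<M) | ∧-zeroʳ (x <ᵇ y) = refl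
      peakAfter-end (_ ∷ _ ∷ _) _ = refl

  peaks-ins-gap : ∀ M σ j → suc j < length σ → All (_< M) σ →
                  peaks (ins M (suc j) σ) + (peakAt σ j + peakAt σ (suc j)) ≡ suc (peaks σ)
  peaks-ins-gap M (_ ∷ []) _ (s≤s ()) _
  peaks-ins-gap M (_ ∷ _ ∷ []) (suc _) (s≤s (s≤s ())) _
  peaks-ins-gap M (a ∷ b ∷ xs) zero _ (a<M ∷ b<M ∷ xs<M)
    rewrite peaks-∷ a (M ∷ b ∷ xs) | <ᵇ-true a<M | <ᵇ-true b<M | peaks-top-∷ M (b ∷ xs) (b<M ∷ xs<M)
          | peaks-∷ a (b ∷ xs) = shuffle (peaks (b ∷ xs)) (peakAfter a (b ∷ xs))
    where
      shuffle : ∀ p q → suc (p + (0 + q)) ≡ suc (q + p)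
      shuffle = solve-∀
  peaks-ins-gap M (a ∷ b ∷ c ∷ xs) (suc zero) _ (a<M ∷ b<M ∷ c<M ∷ xs<M)
    rewrite peaks-∷ a (b ∷ M ∷ c ∷ xs) | <ᵇ-false (<⇒≤ b<M) | ∧-zeroʳ (a <ᵇ b)
          | peaks-∷ b (M ∷ c ∷ xs) | <ᵇ-true b<M | <ᵇ-true c<M | peaks-top-∷ M (c ∷ xs) (c<M ∷ xs<M)
          | peaks-∷ a (b ∷ c ∷ xs) | peaks-∷ b (c ∷ xs) =
    shuffle (peaks (c ∷ xs)) (peakAfter a (b ∷ c ∷ xs)) (peakAfter b (c ∷ xs))
    where
      shuffle : ∀ p q r → (1 + p) + (q + r) ≡ suc (q + (r + p))
      shuffle = solve-∀
  peaks-ins-gap M (a ∷ b ∷ c ∷ xs) (suc (suc j)) (s≤s j<) (_ ∷ bcxs<M) =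
    trans (+-assoc (peakAfter a (b ∷ c ∷ xs)) _ _)
          (trans (cong (peakAfter a (b ∷ c ∷ xs) +_) (peaks-ins-gap M (b ∷ c ∷ xs) (suc j) j< bcxs<M)) (+-suc _ _))

  lrminAux-cong : ∀ M {p q} xs → (∀ {y} → y < M → all (y <ᵇ_) p ≡ all (y <ᵇ_) q) → All (_< M) xs →
                  lrminAux p xs ≡ lrminAux q xs
  lrminAux-cong M [] _ _ = refl
  lrminAux-cong M (x ∷ xs) p≈q (x<M ∷ xs<M) =
    cong₂ _+_ (cong indicator (p≈q x<M)) (lrminAux-cong M xs (λ y<M → cong ((_ <ᵇ x) ∧_) (p≈q y<M)) xs<M)

  lrminAux-top : ∀ M p xs → All (_< M) xs → lrminAux (M ∷ p) xs ≡ lrminAux p xs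
  lrminAux-top M p xs = lrminAux-cong M xs (λ {y} y<M → cong (_∧ all (y <ᵇ_) p) (<ᵇ-true y<M))

  lrminAux-ins : ∀ M p i xs → all (M <ᵇ_) p ≡ false → All (_< M) xs → lrminAux p (ins M i xs) ≡ lrminAux p xs
  lrminAux-ins M p zero xs M-not-min xs<M = cong₂ _+_ (cong indicator M-not-min) (lrminAux-top M p xs xs<M)
  lrminAux-ins M p (suc i) [] M-not-min _ = cong (λ b → indicator b + 0) M-not-min
  lrminAux-ins M p (suc i) (x ∷ xs) M-not-min (x<M ∷ xs<M) =
    cong (indicator (all (x <ᵇ_) p) +_)
         (lrminAux-ins M (x ∷ p) i xs (cong (_∧ all (M <ᵇ_) p) (<ᵇ-false (<⇒≤ x<M))) xs<M)

  LRmin-top-∷ : ∀ M σ → All (_< M) σ → LRmin (M ∷ σ) ≡ suc (LRmin σ)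
  LRmin-top-∷ M σ σ<M = cong suc (lrminAux-top M [] σ σ<M)

  LRmin-ins-suc : ∀ M i x xs → All (_< M) (x ∷ xs) → LRmin (ins M (suc i) (x ∷ xs)) ≡ LRmin (x ∷ xs)
  LRmin-ins-suc M i x xs (x<M ∷ xs<M) = cong suc (lrminAux-ins M (x ∷ []) i xs (cong (_∧ true) (<ᵇ-false (<⇒≤ x<M))) xs<M)

  all-<ᵇ-ins : ∀ M {a} i xs → a < M → all (a <ᵇ_) (ins M i xs) ≡ all (a <ᵇ_) xs
  all-<ᵇ-ins M {a} zero xs a<M = cong (_∧ all (a <ᵇ_) xs) (<ᵇ-true a<M)
  all-<ᵇ-ins M (suc i) [] a<M = cong (_∧ true) (<ᵇ-true a<M)
  all-<ᵇ-ins M (suc i) (x ∷ xs) a<M = cong ((_ <ᵇ x) ∧_) (all-<ᵇ-ins M i xs a<M)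

  RLmin-ins-inner : ∀ M i σ → i < length σ → All (_< M) σ → RLmin (ins M i σ) ≡ RLmin σ
  RLmin-ins-inner M zero (x ∷ xs) _ (x<M ∷ _) =
    cong (λ b → indicator b + RLmin (x ∷ xs)) (cong (_∧ all (M <ᵇ_) xs) (<ᵇ-false (<⇒≤ x<M)))
  RLmin-ins-inner M (suc i) (x ∷ xs) (s≤s i<) (x<M ∷ xs<M) =
    cong₂ _+_ (cong indicator (all-<ᵇ-ins M i xs x<M)) (RLmin-ins-inner M i xs i< xs<M)

  RLmin-ins-end : ∀ M σ → All (_< M) σ → RLmin (ins M (length σ) σ) ≡ suc (RLmin σ)
  RLmin-ins-end M [] _ = refl
  RLmin-ins-end M (x ∷ xs) (x<M ∷ xs<M) =
    trans (cong₂ _+_ (cong indicator (all-<ᵇ-ins M (length xs) xs x<M)) (RLmin-ins-end M xs xs<M)) (+-suc _ _)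

  RLmin-∷-positive : ∀ x xs → 1 ≤ RLmin (x ∷ xs)
  RLmin-∷-positive x [] = s≤s z≤n
  RLmin-∷-positive x (y ∷ ys) = ≤-trans (RLmin-∷-positive y ys) (m≤n+m _ (indicator (all (x <ᵇ_) (y ∷ ys))))

module FiniteDifferences {c ℓ : Level} (R : CommutativeRing c ℓ) where
  open CommutativeRing R
  open import Data.Nat as ℕ using (ℕ; zero; suc)
  open import Function using (_∘_)
  import Relation.Binary.PropositionalEquality as ≡
  open import Algebra.Properties.CommutativeMonoid.Mult +-commutativeMonoid using (_×_; ×-congʳ; ×-distrib-+)
  open import Algebra.Properties.Ring ring using (-0#≈0#; x[y-z]≈xy-xz; [y-z]x≈yx-zx)
  open import Algebra.Properties.AbelianGroup +-abelianGroup using (⁻¹-∙-comm)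
  open import Relation.Binary.Reasoning.Setoid setoid
  open import Algebra.Properties.CommutativeSemigroup +-commutativeSemigroup using (interchange; x∙yz≈xz∙y; xy∙z≈x∙zy)

  ×-distrib-− : ∀ n x y → n × (x - y) ≈ n × x - n × y
  ×-distrib-− n x y = trans (×-distrib-+ x (- y) n) (+-congˡ (×-neg n y))
    where
      ×-neg : ∀ n y → n × (- y) ≈ - (n × y)
      ×-neg zero y = sym -0#≈0#
      ×-neg (suc n) y = trans (+-congˡ (×-neg n y)) (⁻¹-∙-comm y (n × y))

  Δ : (ℕ → Carrier) → ℕ → Carrier
  Δ f k = f k - f (suc k)

  Δ^ : ℕ → (ℕ → Carrier) → ℕ → Carrier
  Δ^ zero f = f
  Δ^ (suc j) f = Δ^ j (Δ f)

  Δ^-cong : ∀ j {f h : ℕ → Carrier} → (∀ k → f k ≈ h k) → ∀ k → Δ^ j f k ≈ Δ^ j h k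
  Δ^-cong zero f≈h = f≈h
  Δ^-cong (suc j) f≈h = Δ^-cong j (λ k → +-cong (f≈h k) (-‿cong (f≈h (suc k))))

  Δ^-shift : ∀ j f k → Δ^ j (f ∘ suc) k ≡.≡ Δ^ j f (suc k)
  Δ^-shift zero f k = ≡.refl
  Δ^-shift (suc j) f k = Δ^-shift j (Δ f) k

  Δ^-+ : ∀ j f h k → Δ^ j (λ k → f k + h k) k ≈ Δ^ j f k + Δ^ j h k
  Δ^-+ zero f h k = refl
  Δ^-+ (suc j) f h k = trans (Δ^-cong j (λ k → Δ-+ (f k) (h k) (f (suc k)) (h (suc k))) k) (Δ^-+ j (Δ f) (Δ h) k)
    where
      Δ-+ : ∀ a b c d → (a + b) - (c + d) ≈ (a - c) + (b - d)
      Δ-+ a b c d = trans (+-congˡ (sym (⁻¹-∙-comm c d))) (interchange a b (- c) (- d))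

  Δ^-natural : (φ : Carrier → Carrier) → (∀ {x y} → x ≈ y → φ x ≈ φ y) → (∀ x y → φ (x - y) ≈ φ x - φ y) →
               ∀ j f k → Δ^ j (φ ∘ f) k ≈ φ (Δ^ j f k)
  Δ^-natural φ φ-cong φ-− zero f k = refl
  Δ^-natural φ φ-cong φ-− (suc j) f k =
    trans (Δ^-cong j (λ k → sym (φ-− (f k) (f (suc k)))) k) (Δ^-natural φ φ-cong φ-− j (Δ f) k)

  Δ^-*ˡ : ∀ j a f k → Δ^ j (λ k → a * f k) k ≈ a * Δ^ j f k
  Δ^-*ˡ j a = Δ^-natural (a *_) *-congˡ (x[y-z]≈xy-xz a) j

  Δ^-× : ∀ j n f k → Δ^ j (λ k → n × f k) k ≈ n × Δ^ j f k
  Δ^-× j n = Δ^-natural (n ×_) (×-congʳ n) (×-distrib-− n) j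

  Δ^-neg : ∀ j f k → Δ^ j (λ k → - f k) k ≈ - Δ^ j f k
  Δ^-neg = Δ^-natural -_ -‿cong (λ x y → sym (⁻¹-∙-comm x (- y)))

  Δ^-− : ∀ j f h k → Δ^ j (λ k → f k - h k) k ≈ Δ^ j f k - Δ^ j h k
  Δ^-− j f h k = trans (Δ^-+ j f (λ k → - h k) k) (+-congˡ (Δ^-neg j h k))

  Δ^-suc : ∀ j f k → Δ^ (suc j) f k ≈ Δ^ j f k - Δ^ j f (suc k)
  Δ^-suc j f k = trans (Δ^-− j f (f ∘ suc) k) (+-congˡ (-‿cong (reflexive (Δ^-shift j f k))))

  Δ-index× : ∀ f k → Δ (λ k → k × f k) k ≈ k × Δ f k - f (suc k)
  Δ-index× f k = begin
    k × f k - (f (suc k) + k × f (suc k))   ≈⟨ +-congˡ (⁻¹-∙-comm (f (suc k)) (k × f (suc k))) ⟨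
    k × f k + (- f (suc k) - k × f (suc k)) ≈⟨ x∙yz≈xz∙y (k × f k) (- f (suc k)) (- (k × f (suc k))) ⟩
    (k × f k - k × f (suc k)) - f (suc k)   ≈⟨ +-congʳ (×-distrib-− k (f k) (f (suc k))) ⟨
    k × Δ f k - f (suc k)                   ∎

  Δ^-index× : ∀ j f k → Δ^ (suc j) (λ k → k × f k) k ≈ k × Δ^ (suc j) f k - suc j × Δ^ j f (suc k)
  Δ^-index× zero f k = trans (Δ-index× f k) (+-congˡ (-‿cong (sym (+-identityʳ _))))
  Δ^-index× (suc j) f k = begin
    Δ^ (suc j) (Δ (λ k → k × f k)) k                              ≈⟨ Δ^-cong (suc j) (Δ-index× f) k ⟩
    Δ^ (suc j) (λ k → k × Δ f k - f (suc k)) k                    ≈⟨ Δ^-− (suc j) _ (f ∘ suc) k ⟩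
    Δ^ (suc j) (λ k → k × Δ f k) k - Δ^ (suc j) (f ∘ suc) k       ≈⟨ +-cong (Δ^-index× j (Δ f) k) (-‿cong (reflexive (Δ^-shift (suc j) f k))) ⟩
    (k × X - suc j × Y) - Y                                        ≈⟨ xy∙z≈x∙zy (k × X) (- (suc j × Y)) (- Y) ⟩
    k × X + (- Y - suc j × Y)                                      ≈⟨ +-congˡ (⁻¹-∙-comm Y (suc j × Y)) ⟩
    k × X - suc (suc j) × Y                                        ∎
    where
      X Y : Carrier
      X = Δ^ (suc (suc j)) f k
      Y = Δ^ (suc j) f (suc k)

  Δ^-index×-at-0 : ∀ j f → Δ^ j (λ k → k × Δ f k) 0 ≈ - (j × Δ^ j f 1)
  Δ^-index×-at-0 zero f = sym -0#≈0#
  Δ^-index×-at-0 (suc j) f = trans (Δ^-index× j (Δ f) 0) (+-identityˡ _)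

  Δ^-pow : ∀ j u k → Δ^ j (pow R u) k ≈ pow R (1# - u) j * pow R u k
  Δ^-pow zero u k = sym (*-identityˡ _)
  Δ^-pow (suc j) u k = begin
    Δ^ j (Δ (pow R u)) k                        ≈⟨ Δ^-cong j Δ-pow k ⟩
    Δ^ j (λ k → (1# - u) * pow R u k) k         ≈⟨ Δ^-*ˡ j (1# - u) (pow R u) k ⟩
    (1# - u) * Δ^ j (pow R u) k                 ≈⟨ *-congˡ (Δ^-pow j u k) ⟩
    (1# - u) * (pow R (1# - u) j * pow R u k)   ≈⟨ *-assoc _ _ _ ⟨
    pow R (1# - u) (suc j) * pow R u k          ∎
    where
      Δ-pow : ∀ k → Δ (pow R u) k ≈ (1# - u) * pow R u k
      Δ-pow k = begin
        pow R u k - u * pow R u k          ≈⟨ +-congʳ (*-identityˡ _) ⟨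
        1# * pow R u k - u * pow R u k     ≈⟨ [y-z]x≈yx-zx (pow R u k) 1# u ⟨
        (1# - u) * pow R u k               ∎

module PeakRecurrence {c ℓ : Level} (R : CommutativeRing c ℓ) where
  open CommutativeRing R
  open FiniteDifferences R
  open import Data.Nat as ℕ using (ℕ; suc)
  open import Function using (_∘_)
  open import Algebra.Properties.CommutativeMonoid.Mult +-commutativeMonoid using (_×_; ×-congʳ; ×-homo-+)
  open import Algebra.Properties.AbelianGroup +-abelianGroup using (⁻¹-anti-homo‿-; ⁻¹-∙-comm)
  open import Algebra.Properties.Group +-group using (//-rightDividesʳ)
  open import Relation.Binary.Reasoning.Setoid setoid

  peakStep : ℕ → (ℕ → Carrier) → ℕ → Carrier
  peakStep n g k = n × g (suc k) + (k ℕ.+ k) × Δ g k - g k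

  Δ^-peakStep : ∀ m j g → Δ^ j (peakStep (m ℕ.+ (j ℕ.+ j)) g) 0 ≈ m × Δ^ j g 1 - Δ^ j g 0
  Δ^-peakStep m j g = begin
    Δ^ j (peakStep (m ℕ.+ (j ℕ.+ j)) g) 0
      ≈⟨ Δ^-− j _ g 0 ⟩
    Δ^ j (λ k → (m ℕ.+ (j ℕ.+ j)) × g (suc k) + (k ℕ.+ k) × Δ g k) 0 - X
      ≈⟨ +-congʳ (Δ^-+ j _ _ 0) ⟩
    (Δ^ j (λ k → (m ℕ.+ (j ℕ.+ j)) × g (suc k)) 0 + Δ^ j (λ k → (k ℕ.+ k) × Δ g k) 0) - X
      ≈⟨ +-congʳ (+-cong shifted doubled) ⟩
    ((m × Y + (j ℕ.+ j) × Y) - (j ℕ.+ j) × Y) - X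
      ≈⟨ +-congʳ (//-rightDividesʳ ((j ℕ.+ j) × Y) (m × Y)) ⟩
    m × Y - X ∎
    where
      X Y : Carrier
      X = Δ^ j g 0
      Y = Δ^ j g 1
      shifted : Δ^ j (λ k → (m ℕ.+ (j ℕ.+ j)) × g (suc k)) 0 ≈ m × Y + (j ℕ.+ j) × Y
      shifted = begin
        Δ^ j (λ k → (m ℕ.+ (j ℕ.+ j)) × g (suc k)) 0   ≈⟨ Δ^-× j (m ℕ.+ (j ℕ.+ j)) (g ∘ suc) 0 ⟩
        (m ℕ.+ (j ℕ.+ j)) × Δ^ j (g ∘ suc) 0          ≈⟨ ×-congʳ (m ℕ.+ (j ℕ.+ j)) (reflexive (Δ^-shift j g 0)) ⟩
        (m ℕ.+ (j ℕ.+ j)) × Y                          ≈⟨ ×-homo-+ Y m (j ℕ.+ j) ⟩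
        m × Y + (j ℕ.+ j) × Y                          ∎
      doubled : Δ^ j (λ k → (k ℕ.+ k) × Δ g k) 0 ≈ - ((j ℕ.+ j) × Y)
      doubled = begin
        Δ^ j (λ k → (k ℕ.+ k) × Δ g k) 0                    ≈⟨ Δ^-cong j (λ k → ×-homo-+ (Δ g k) k k) 0 ⟩
        Δ^ j (λ k → k × Δ g k + k × Δ g k) 0                ≈⟨ Δ^-+ j _ _ 0 ⟩
        Δ^ j (λ k → k × Δ g k) 0 + Δ^ j (λ k → k × Δ g k) 0 ≈⟨ +-cong (Δ^-index×-at-0 j g) (Δ^-index×-at-0 j g) ⟩
        - (j × Y) + - (j × Y)                                ≈⟨ ⁻¹-∙-comm (j × Y) (j × Y) ⟩
        - (j × Y + j × Y)                                    ≈⟨ -‿cong (×-homo-+ Y j j) ⟨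
        - ((j ℕ.+ j) × Y)                                    ∎

  Δ^-peakStep-even : ∀ j g → Δ^ j (peakStep (j ℕ.+ j) g) 0 ≈ - Δ^ j g 0
  Δ^-peakStep-even j g = trans (Δ^-peakStep 0 j g) (+-identityˡ _)

  Δ^-peakStep-odd : ∀ j g → Δ^ j (peakStep (suc (j ℕ.+ j)) g) 0 ≈ - Δ^ (suc j) g 0
  Δ^-peakStep-odd j g = begin
    Δ^ j (peakStep (suc (j ℕ.+ j)) g) 0   ≈⟨ Δ^-peakStep 1 j g ⟩
    (Y + 0#) - X                          ≈⟨ +-congʳ (+-identityʳ Y) ⟩
    Y - X                                 ≈⟨ ⁻¹-anti-homo‿- X Y ⟨
    - (X - Y)                             ≈⟨ -‿cong (Δ^-suc j g 0) ⟨
    - Δ^ (suc j) g 0                      ∎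
    where
      X Y : Carrier
      X = Δ^ j g 0
      Y = Δ^ j g 1

module PermutationSums {c ℓ : Level} (R : CommutativeRing c ℓ) where
  open CommutativeRing R
  open FiniteDifferences R
  open PeakRecurrence R
  open Permutations using (ins; insertions; perms-suc-↭; ∈-perms⁻)
  open InsertionStatistics
  open import Data.Nat as ℕ using (ℕ; zero; suc; _≤_; _<_; z≤n; s≤s; _∸_)
  open import Data.Nat.Properties as ℕ using ()
  open import Data.Fin using (Fin; toℕ; fromℕ; inject₁)
  open import Data.Fin.Properties using (toℕ<n; toℕ-inject₁; toℕ-fromℕ)
  open import Data.List using (List; []; _∷_; map; concatMap; length; _++_)
  open import Data.List.Properties using (map-++; map-∘)
  open import Data.List.Relation.Unary.All as All using (All; []; _∷_)
  open import Data.List.Relation.Unary.Any using (here; there)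
  open import Data.List.Membership.Propositional using (_∈_)
  open import Data.List.Relation.Binary.Permutation.Propositional using (_↭_; ↭⇒↭ₛ′)
  open import Data.List.Relation.Binary.Permutation.Propositional.Properties using (map⁺)
  open import Data.List.Relation.Binary.Permutation.Setoid.Properties setoid using (foldr-commMonoid)
  open import Data.Product using (_,_)
  open import Function using (_∘_)
  import Relation.Binary.PropositionalEquality as ≡
  open import Algebra.Properties.CommutativeMonoid.Mult +-commutativeMonoid using (_×_; ×-homo-+)
  open import Algebra.Properties.CommutativeMonoid.Sum +-commutativeMonoid
    using (sum-syntax; sum-cong-≋; sum-init-last; sum-replicate; sum-replicate-zero; ∑-distrib-+)
  open import Algebra.Properties.Semiring.Sum semiring using (*-distribʳ-sum)
  open import Algebra.Properties.Group +-group using (//-rightDividesˡ; ⁻¹-involutive)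
  open import Algebra.Properties.Ring ring using (-1*x≈-x)
  open import Algebra.Properties.CommutativeSemigroup *-commutativeSemigroup using (x∙yz≈y∙xz)
  open import Algebra.Solver.Ring.NaturalCoefficients.Default commutativeSemiring using (solve; _:=_; _:+_; _:*_)
  open import Relation.Binary.Reasoning.Setoid setoid

  sumR-↭ : ∀ {xs ys} → xs ↭ ys → sumR R xs ≈ sumR R ys
  sumR-↭ p = foldr-commMonoid +-isCommutativeMonoid (↭⇒↭ₛ′ isEquivalence p)

  sumR-++ : ∀ xs ys → sumR R (xs ++ ys) ≈ sumR R xs + sumR R ys
  sumR-++ [] ys = sym (+-identityˡ _)
  sumR-++ (x ∷ xs) ys = trans (+-congˡ (sumR-++ xs ys)) (sym (+-assoc _ _ _))

  sumR-map-concatMap : ∀ {A B : Set} (F : B → Carrier) (f : A → List B) xs →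
                       sumR R (map F (concatMap f xs)) ≈ sumR R (map (λ x → sumR R (map F (f x))) xs)
  sumR-map-concatMap F f [] = refl
  sumR-map-concatMap F f (x ∷ xs) = begin
    sumR R (map F (f x ++ concatMap f xs))                  ≡⟨ ≡.cong (sumR R) (map-++ F (f x) (concatMap f xs)) ⟩
    sumR R (map F (f x) ++ map F (concatMap f xs))          ≈⟨ sumR-++ (map F (f x)) _ ⟩
    sumR R (map F (f x)) + sumR R (map F (concatMap f xs))  ≈⟨ +-congˡ (sumR-map-concatMap F f xs) ⟩
    sumR R (map F (f x)) + sumR R (map (λ x → sumR R (map F (f x))) xs) ∎

  sumR-map-cong-∈ : ∀ {A : Set} xs {F G : A → Carrier} → (∀ {x} → x ∈ xs → F x ≈ G x) →
                    sumR R (map F xs) ≈ sumR R (map G xs)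
  sumR-map-cong-∈ [] _ = refl
  sumR-map-cong-∈ (x ∷ xs) F≈G = +-cong (F≈G (here ≡.refl)) (sumR-map-cong-∈ xs (F≈G ∘ there))

  sumR-insertions : ∀ M σ (H : List ℕ → Carrier) →
                    sumR R (map H (insertions M σ)) ≈ ∑[ i < suc (length σ) ] H (ins M (toℕ i) σ)
  sumR-insertions M [] H = refl
  sumR-insertions M (x ∷ xs) H =
    +-congˡ (trans (reflexive (≡.cong (sumR R) (≡.sym (map-∘ (insertions M xs))))) (sumR-insertions M xs (H ∘ (x ∷_))))

  ∑-peakAt-suc : ∀ σ n x → length σ ≤ suc (suc n) → ∑[ j < n ] (peakAt σ (suc (toℕ j)) × x) ≈ peaks σ × x
  ∑-peakAt-suc [] zero x _ = refl
  ∑-peakAt-suc (_ ∷ []) zero x _ = refl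
  ∑-peakAt-suc (_ ∷ _ ∷ []) zero x _ = refl
  ∑-peakAt-suc (_ ∷ _ ∷ _ ∷ _) zero x (s≤s (s≤s ()))
  ∑-peakAt-suc [] (suc n) x _ = trans (+-identityˡ _) (sum-replicate-zero n)
  ∑-peakAt-suc (a ∷ τ) (suc n) x (s≤s len≤) = begin
    peakAfter a τ × x + ∑[ j < n ] (peakAt τ (suc (toℕ j)) × x) ≈⟨ +-congˡ (∑-peakAt-suc τ n x len≤) ⟩
    peakAfter a τ × x + peaks τ × x                            ≈⟨ ×-homo-+ x (peakAfter a τ) (peaks τ) ⟨
    (peakAfter a τ ℕ.+ peaks τ) × x                            ≡⟨ ≡.cong (_× x) (peaks-∷ a τ) ⟨
    peaks (a ∷ τ) × x                                          ∎

  ∑-peakAt : ∀ σ n x → length σ ≡.≡ suc n → ∑[ j < n ] (peakAt σ (toℕ j) × x) ≈ peaks σ × x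
  ∑-peakAt (a ∷ []) zero x _ = refl
  ∑-peakAt (a ∷ τ) (suc n) x len = trans (+-identityˡ _) (∑-peakAt-suc (a ∷ τ) n x (ℕ.≤-reflexive len))

  gapValue : ∀ g k e d → e ℕ.+ d ≡.≡ suc k → d ≤ 1 → g e ≈ g (suc k) + d × Δ g k
  gapValue g k e zero e+0≡ _ = begin
    g e              ≡⟨ ≡.cong g (≡.trans (≡.sym (ℕ.+-identityʳ e)) e+0≡) ⟩
    g (suc k)        ≈⟨ +-identityʳ _ ⟨
    g (suc k) + 0#   ∎
  gapValue g k e (suc zero) e+1≡ _ = begin
    g e                                ≡⟨ ≡.cong g (ℕ.suc-injective (≡.trans (ℕ.+-comm 1 e) e+1≡)) ⟩
    g k                                ≈⟨ //-rightDividesˡ (g (suc k)) (g k) ⟨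
    (g k - g (suc k)) + g (suc k)      ≈⟨ +-comm _ _ ⟩
    g (suc k) + Δ g k                  ≈⟨ +-congˡ (+-identityʳ _) ⟨
    g (suc k) + 1 × Δ g k              ∎
  gapValue g k e (suc (suc d)) _ (s≤s ())

  ∑-gaps : ∀ g M σ n → length σ ≡.≡ suc n → All (ℕ._< M) σ →
           ∑[ j < n ] g (peaks (ins M (suc (toℕ j)) σ)) ≈ n × g (suc (peaks σ)) + (peaks σ ℕ.+ peaks σ) × Δ g (peaks σ)
  ∑-gaps g M σ n len σ<M = begin
    ∑[ j < n ] g (peaks (ins M (suc (toℕ j)) σ))
      ≈⟨ sum-cong-≋ {n} (λ j → gapValue g k _ _ (peaks-ins-gap M σ (toℕ j) (gap< j) σ<M) (peakAt-adjacent σ (toℕ j))) ⟩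
    ∑[ j < n ] (g (suc k) + d j × D)
      ≈⟨ ∑-distrib-+ {n} (λ _ → g (suc k)) (λ j → d j × D) ⟩
    ∑[ j < n ] g (suc k) + ∑[ j < n ] (d j × D)
      ≈⟨ +-cong (sum-replicate n) (sum-cong-≋ {n} (λ j → ×-homo-+ D (left j) (right j))) ⟩
    n × g (suc k) + ∑[ j < n ] (left j × D + right j × D)
      ≈⟨ +-congˡ (∑-distrib-+ {n} (λ j → left j × D) (λ j → right j × D)) ⟩
    n × g (suc k) + (∑[ j < n ] (left j × D) + ∑[ j < n ] (right j × D))
      ≈⟨ +-congˡ (+-cong (∑-peakAt σ n D len) (∑-peakAt-suc σ n D (ℕ.≤-trans (ℕ.≤-reflexive len) (ℕ.n≤1+n _)))) ⟩
    n × g (suc k) + (k × D + k × D)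
      ≈⟨ +-congˡ (×-homo-+ D k k) ⟨
    n × g (suc k) + (k ℕ.+ k) × D ∎
    where
      k : ℕ
      k = peaks σ
      D : Carrier
      D = Δ g k
      left right d : Fin n → ℕ
      left j = peakAt σ (toℕ j)
      right j = peakAt σ (suc (toℕ j))
      d j = left j ℕ.+ right j
      gap< : ∀ (j : Fin n) → suc (toℕ j) < length σ
      gap< j = ≡.subst (suc (toℕ j) <_) (≡.sym len) (s≤s (toℕ<n j))

  pow-pred : ∀ x {r} → 1 ≤ r → pow R x r ≡.≡ x * pow R x (r ∸ 1)
  pow-pred x {suc r} _ = ≡.refl

  module Weighted (α β : Carrier) where

    weight : List ℕ → Carrier
    weight τ = pow R α (LRmin τ ∸ 1) * pow R β (RLmin τ ∸ 1)

    weighted : (ℕ → Carrier) → List ℕ → Carrier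
    weighted g τ = g (peaks τ) * weight τ

    permSumOf : (ℕ → Carrier) → ℕ → Carrier
    permSumOf g m = sumR R (map (weighted g) (perms m))

    weight-≡ : ∀ τ {l r} → LRmin τ ≡.≡ l → RLmin τ ≡.≡ r → weight τ ≡.≡ pow R α (l ∸ 1) * pow R β (r ∸ 1)
    weight-≡ τ ≡.refl ≡.refl = ≡.refl

    weight-front : ∀ M x xs → All (ℕ._< M) (x ∷ xs) → weight (M ∷ x ∷ xs) ≈ α * weight (x ∷ xs)
    weight-front M x xs σ<M = begin
      weight (M ∷ x ∷ xs)
        ≡⟨ weight-≡ (M ∷ x ∷ xs) (LRmin-top-∷ M (x ∷ xs) σ<M) (RLmin-ins-inner M 0 (x ∷ xs) (s≤s z≤n) σ<M) ⟩
      (α * pow R α (LRmin (x ∷ xs) ∸ 1)) * pow R β (RLmin (x ∷ xs) ∸ 1)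
        ≈⟨ *-assoc _ _ _ ⟩
      α * weight (x ∷ xs) ∎

    weight-end : ∀ M x xs → All (ℕ._< M) (x ∷ xs) → weight (ins M (suc (length xs)) (x ∷ xs)) ≈ β * weight (x ∷ xs)
    weight-end M x xs σ<M = begin
      weight (ins M (suc (length xs)) (x ∷ xs))
        ≡⟨ weight-≡ (ins M (suc (length xs)) (x ∷ xs)) (LRmin-ins-suc M (length xs) x xs σ<M) (RLmin-ins-end M (x ∷ xs) σ<M) ⟩
      pow R α (LRmin (x ∷ xs) ∸ 1) * pow R β (RLmin (x ∷ xs))
        ≡⟨ ≡.cong (pow R α (LRmin (x ∷ xs) ∸ 1) *_) (pow-pred β (RLmin-∷-positive x xs)) ⟩
      pow R α (LRmin (x ∷ xs) ∸ 1) * (β * pow R β (RLmin (x ∷ xs) ∸ 1))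
        ≈⟨ x∙yz≈y∙xz _ β _ ⟩
      β * weight (x ∷ xs) ∎

    weight-inner : ∀ M i x xs → i < length xs → All (ℕ._< M) (x ∷ xs) → weight (ins M (suc i) (x ∷ xs)) ≡.≡ weight (x ∷ xs)
    weight-inner M i x xs i< σ<M = weight-≡ (ins M (suc i) (x ∷ xs)) (LRmin-ins-suc M i x xs σ<M) (RLmin-ins-inner M (suc i) (x ∷ xs) (s≤s i<) σ<M)

    permSumOf-one : ∀ g → permSumOf g 1 ≈ g 0
    permSumOf-one g = trans (+-identityʳ _) (trans (*-congˡ (*-identityˡ 1#)) (*-identityʳ _))

    module _ (α+β≈-1 : α + β ≈ - 1#) where

      sumR-insertions-weighted : ∀ g M x xs → All (ℕ._< M) (x ∷ xs) →
        sumR R (map (weighted g) (insertions M (x ∷ xs))) ≈ weighted (peakStep (length xs) g) (x ∷ xs)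
      sumR-insertions-weighted g M x xs σ<M = begin
        sumR R (map (weighted g) (insertions M σ))
          ≈⟨ sumR-insertions M σ (weighted g) ⟩
        weighted g (M ∷ σ) + ∑[ i < suc n ] weighted g (ins M (suc (toℕ i)) σ)
          ≈⟨ +-congˡ (sum-init-last {n} (λ i → weighted g (ins M (suc (toℕ i)) σ))) ⟩
        weighted g (M ∷ σ) + (∑[ j < n ] weighted g (ins M (suc (toℕ (inject₁ j))) σ)
                              + weighted g (ins M (suc (toℕ (fromℕ n))) σ))
          ≈⟨ +-cong front (+-cong middle back) ⟩
        g k * (α * W) + (S * W + g k * (β * W))
          ≈⟨ solve 5 (λ g a b W S → g :* (a :* W) :+ (S :* W :+ g :* (b :* W)) := (g :* (a :+ b) :+ S) :* W)
                     refl (g k) α β W S ⟩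
        (g k * (α + β) + S) * W
          ≈⟨ *-congʳ (+-cong (trans (*-congˡ α+β≈-1) (trans (*-comm _ _) (-1*x≈-x (g k)))) (∑-gaps g M σ n ≡.refl σ<M)) ⟩
        (- g k + (n × g (suc k) + (k ℕ.+ k) × Δ g k)) * W
          ≈⟨ *-congʳ (+-comm _ _) ⟩
        weighted (peakStep n g) σ ∎
        where
          σ : List ℕ
          σ = x ∷ xs
          n k : ℕ
          n = length xs
          k = peaks σ
          W S : Carrier
          W = weight σ
          S = ∑[ j < n ] g (peaks (ins M (suc (toℕ j)) σ))
          front : weighted g (M ∷ σ) ≈ g k * (α * W)
          front = *-cong (reflexive (≡.cong g (peaks-top-∷ M σ σ<M))) (weight-front M x xs σ<M)
          back : weighted g (ins M (suc (toℕ (fromℕ n))) σ) ≈ g k * (β * W)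
          back rewrite toℕ-fromℕ n = *-cong (reflexive (≡.cong g (peaks-ins-end M σ σ<M))) (weight-end M x xs σ<M)
          middle : ∑[ j < n ] weighted g (ins M (suc (toℕ (inject₁ j))) σ) ≈ S * W
          middle = begin
            ∑[ j < n ] weighted g (ins M (suc (toℕ (inject₁ j))) σ) ≈⟨ sum-cong-≋ {n} (λ j → reflexive (inner j)) ⟩
            ∑[ j < n ] (g (peaks (ins M (suc (toℕ j)) σ)) * W)      ≈⟨ *-distribʳ-sum {n} W (λ j → g (peaks (ins M (suc (toℕ j)) σ))) ⟨
            S * W                                                  ∎
            where
              inner : ∀ j → weighted g (ins M (suc (toℕ (inject₁ j))) σ) ≡.≡ g (peaks (ins M (suc (toℕ j)) σ)) * W
              inner j rewrite toℕ-inject₁ j = ≡.cong (g (peaks (ins M (suc (toℕ j)) σ)) *_) (weight-inner M (toℕ j) x xs (toℕ<n j) σ<M)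

      permSumOf-suc : ∀ n g → permSumOf g (suc (suc n)) ≈ permSumOf (peakStep n g) (suc n)
      permSumOf-suc n g = begin
        sumR R (map (weighted g) (perms (suc (suc n))))
          ≈⟨ sumR-↭ (map⁺ (weighted g) (perms-suc-↭ (suc n))) ⟩
        sumR R (map (weighted g) (concatMap (insertions (suc (suc n))) (perms (suc n))))
          ≈⟨ sumR-map-concatMap (weighted g) (insertions (suc (suc n))) (perms (suc n)) ⟩
        sumR R (map (λ σ → sumR R (map (weighted g) (insertions (suc (suc n)) σ))) (perms (suc n)))
          ≈⟨ sumR-map-cong-∈ (perms (suc n)) insert ⟩
        sumR R (map (weighted (peakStep n g)) (perms (suc n))) ∎
        where
          insert : ∀ {σ} → σ ∈ perms (suc n) → sumR R (map (weighted g) (insertions (suc (suc n)) σ)) ≈ weighted (peakStep n g) σ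
          insert {σ} σ∈ with ∈-perms⁻ {suc n} σ∈
          insert {x ∷ xs} _ | len , inRange , _ =
            trans (sumR-insertions-weighted g (suc (suc n)) x xs (All.map (λ (_ , a≤n+1) → s≤s a≤n+1) inRange))
                  (reflexive (≡.cong (λ m → weighted (peakStep m g) (x ∷ xs)) (ℕ.suc-injective len)))

      permSumOf-odd : ∀ j g → permSumOf g (suc (j ℕ.+ j)) ≈ Δ^ j g 0
      permSumOf-odd zero g = permSumOf-one g
      permSumOf-odd (suc j) g = begin
        permSumOf g (suc (suc j ℕ.+ suc j))                           ≡⟨ ≡.cong (λ m → permSumOf g (suc (suc m))) (ℕ.+-suc j j) ⟩
        permSumOf g (suc (suc (suc (j ℕ.+ j))))                       ≈⟨ permSumOf-suc (suc (j ℕ.+ j)) g ⟩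
        permSumOf g′ (suc (suc (j ℕ.+ j)))                             ≈⟨ permSumOf-suc (j ℕ.+ j) g′ ⟩
        permSumOf (peakStep (j ℕ.+ j) g′) (suc (j ℕ.+ j))              ≈⟨ permSumOf-odd j (peakStep (j ℕ.+ j) g′) ⟩
        Δ^ j (peakStep (j ℕ.+ j) g′) 0                                ≈⟨ Δ^-peakStep-even j g′ ⟩
        - Δ^ j g′ 0                                                   ≈⟨ -‿cong (Δ^-peakStep-odd j g) ⟩
        - - Δ^ (suc j) g 0                                            ≈⟨ ⁻¹-involutive _ ⟩
        Δ^ (suc j) g 0                                                ∎
        where
          g′ : ℕ → Carrier
          g′ = peakStep (suc (j ℕ.+ j)) g

      permSumOf-even : ∀ j g → permSumOf g (suc (suc (j ℕ.+ j))) ≈ - Δ^ j g 0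
      permSumOf-even j g = begin
        permSumOf g (suc (suc (j ℕ.+ j)))                 ≈⟨ permSumOf-suc (j ℕ.+ j) g ⟩
        permSumOf (peakStep (j ℕ.+ j) g) (suc (j ℕ.+ j))  ≈⟨ permSumOf-odd j (peakStep (j ℕ.+ j) g) ⟩
        Δ^ j (peakStep (j ℕ.+ j) g) 0                     ≈⟨ Δ^-peakStep-even j g ⟩
        - Δ^ j g 0                                        ∎

open import Data.Nat as ℕ using (ℕ; suc; _≤_; _/_; _%_)
open import Data.Nat.Properties using (*-comm; +-identityʳ)
open import Data.Nat.DivMod using (m≡m%n+[m/n]*n)
import Relation.Binary.PropositionalEquality as ≡
open ≡ using (_≡_)
open import Data.Product using (_×_; _,_)
open import Function using (_∘_)

half-decomposition : ∀ n → n ≡ n % 2 ℕ.+ (n / 2 ℕ.+ n / 2)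
half-decomposition n =
  ≡.trans (m≡m%n+[m/n]*n n 2) (≡.cong (n % 2 ℕ.+_) (≡.trans (*-comm (n / 2) 2) (≡.cong (n / 2 ℕ.+_) (+-identityʳ (n / 2)))))

mainTheorem3 : ∀ {c ℓ : Level} (R : CommutativeRing c ℓ) →
    let open CommutativeRing R in
    (α β u : Carrier) → α + β ≈ - 1# → (n : ℕ) → 1 ≤ n →
      (n % 2 ≡ 0 → permSum R (suc n) u α β ≈ pow R (1# - u) (n / 2))
      × (n % 2 ≡ 1 → permSum R (suc n) u α β ≈ - pow R (1# - u) (n / 2))
mainTheorem3 R α β u α+β≈-1 n _ = even , odd
  where
    open CommutativeRing R
    open FiniteDifferences R using (Δ^; Δ^-pow)
    open PermutationSums.Weighted R α β using (permSumOf; permSumOf-odd; permSumOf-even)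
    j : ℕ
    j = n / 2
    halves : ∀ {r} → n % 2 ≡ r → permSum R (suc n) u α β ≈ permSumOf (pow R u) (suc (r ℕ.+ (j ℕ.+ j)))
    halves n%2≡r = reflexive (≡.cong (permSumOf (pow R u) ∘ suc) (≡.trans (half-decomposition n) (≡.cong (ℕ._+ (j ℕ.+ j)) n%2≡r)))
    value : Δ^ j (pow R u) 0 ≈ pow R (1# - u) j
    value = trans (Δ^-pow j u 0) (*-identityʳ _)
    even : n % 2 ≡ 0 → permSum R (suc n) u α β ≈ pow R (1# - u) j
    even n%2≡0 = trans (halves n%2≡0) (trans (permSumOf-odd α+β≈-1 j (pow R u)) value)
    odd : n % 2 ≡ 1 → permSum R (suc n) u α β ≈ - pow R (1# - u) j
    odd n%2≡1 = trans (halves n%2≡1) (trans (permSumOf-even α+β≈-1 j (pow R u)) (-‿cong value))
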